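{- Let $(K,v)$ be a valued field, $\alpha,\beta\in vK$ and $a,b\in K$. Then $(K,v)$ is $B_\alpha(a)$-extremal if and only if it is $B_\beta(b)$-extremal. In particular, $(K,v)$ is $B_\alpha(a)$-extremal if and only if it is extremal.
   Context: $B_\alpha(a)=\{b\in K\mid v(a-b)\ge\alpha\}$; note that the valuation ring is ${\cal O}=B_0(0)$. For $S\subseteq K$, $(K,v)$ is $S$-extremal if for every $n\ge1$ and every polynomial $f\in K[X_1,\dots,X_n]$ the set $vf(S^n)\subseteq vK\cup\{\infty\}$ has a maximum. $(K,v)$ is extremal if it is ${\cal O}$-extremal. -}

module Defs where

open import Level using (Level; _⊔_; suc)
open import Algebra.Bundles using (CommutativeRing)
open import Algebra.Structures using (IsAbelianGroup)
open import Relation.Binary.Structures using (IsTotalOrder)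
open import Relation.Binary.PropositionalEquality using (_≡_)
open import Relation.Nullary using (¬_)
open import Relation.Unary using (Pred; _∈_)
open import Data.Nat using (ℕ)
open import Data.Fin using (Fin)
open import Data.Product using (Σ; _×_; ∃-syntax)
open import Data.Sum using (_⊎_)
open import Function.Bundles using (_⇔_)

record Field (c ℓ : Level) : Set (suc (c ⊔ ℓ)) where
  field
    commutativeRing : CommutativeRing c ℓ
  open CommutativeRing commutativeRing public
  field
    1≉0     : ¬ (1# ≈ 0#)
    inverse : ∀ x → ¬ (x ≈ 0#) → ∃[ y ] (x * y ≈ 1#)

record OrderedAbelianGroup (g : Level) : Set (suc g) where
  infixl 6 _+ᵍ_
  infix 4 _≤ᵍ_
  field
    Γ               : Set g
    _+ᵍ_            : Γ → Γ → Γ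
    0ᵍ              : Γ
    -ᵍ_             : Γ → Γ
    _≤ᵍ_            : Γ → Γ → Set g
    isAbelianGroup  : IsAbelianGroup _≡_ _+ᵍ_ 0ᵍ -ᵍ_
    isTotalOrder    : IsTotalOrder _≡_ _≤ᵍ_
    +-mono-≤        : ∀ {x y} z → x ≤ᵍ y → x +ᵍ z ≤ᵍ y +ᵍ z

data WithInf {g : Level} (Γ : Set g) : Set g where
  fin : Γ → WithInf Γ
  ∞   : WithInf Γ

module _ {g : Level} (G : OrderedAbelianGroup g) where
  open OrderedAbelianGroup G

  data _≤∞_ : WithInf Γ → WithInf Γ → Set g where
    fin≤fin : ∀ {x y} → x ≤ᵍ y → fin x ≤∞ fin y
    _≤∞∞    : ∀ x → x ≤∞ ∞

  _+∞_ : WithInf Γ → WithInf Γ → WithInf Γ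
  fin x +∞ fin y = fin (x +ᵍ y)
  fin x +∞ ∞     = ∞
  ∞     +∞ _     = ∞

-- A valued field (K, v): a field K, an ordered abelian group Γ and a
-- surjective valuation v : K → Γ ∪ {∞} (so that Γ = vK is the value group).
record ValuedField (c ℓ g : Level) : Set (suc (c ⊔ ℓ ⊔ g)) where
  field
    K  : Field c ℓ
    VG : OrderedAbelianGroup g
  open Field K public
  open OrderedAbelianGroup VG public
  field
    v         : Carrier → WithInf Γ
    v-cong    : ∀ {x y} → x ≈ y → v x ≡ v y
    v-∞       : ∀ x → (v x ≡ ∞) ⇔ (x ≈ 0#)
    v-mult    : ∀ x y → v (x * y) ≡ _+∞_ VG (v x) (v y)
    v-ultra   : ∀ x y → (_≤∞_ VG (v x) (v (x + y)) ⊎ _≤∞_ VG (v y) (v (x + y)))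
    v-onto    : ∀ γ → ∃[ x ] (v x ≡ fin γ)

-- Polynomials in K[X₁,…,Xₙ], given as polynomial expressions.
data Poly {a : Level} (A : Set a) (n : ℕ) : Set a where
  con  : A → Poly A n
  var  : Fin n → Poly A n
  _:+_ : Poly A n → Poly A n → Poly A n
  _:*_ : Poly A n → Poly A n → Poly A n

module _ {c ℓ g : Level} (F : ValuedField c ℓ g) where
  open ValuedField F

  eval : ∀ {n} → Poly Carrier n → (Fin n → Carrier) → Carrier
  eval (con k)  x = k
  eval (var i)  x = x i
  eval (p :+ q) x = eval p x + eval q x
  eval (p :* q) x = eval p x * eval q x

  B : Γ → Carrier → Pred Carrier g
  B α a b = _≤∞_ VG (fin α) (v (a - b))

  𝒪 : Pred Carrier g
  𝒪 = B 0ᵍ 0#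

  IsExtremalOn : ∀ {s} → Pred Carrier s → Set (c ⊔ g ⊔ s)
  IsExtremalOn S = ∀ (n : ℕ) (f : Poly Carrier n) →
    Σ (Fin n → Carrier) λ x → ((∀ i → x i ∈ S) ×
      (∀ (y : Fin n → Carrier) → (∀ i → y i ∈ S) →
         _≤∞_ VG (v (eval f y)) (v (eval f x))))

  IsExtremal : Set (c ⊔ g)
  IsExtremal = IsExtremalOn 𝒪

module Submission where

-- The idea: any two balls are related by an affine bijection of K.  If
-- v d = -α + β and e is the inverse of d, then  z ↦ b - (a - z)·d  maps
-- B_α(a) into B_β(b), because v(b - (b - (a - z)·d)) = v(a - z) + v d,
-- and the map with the roles of (α, a, d) and (β, b, e) swapped is a right
-- inverse of it.  Since an affine map is polynomial, precomposing with it
-- turns a polynomial f in n variables into another polynomial f ∘ ψ, so a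
-- maximum of v (f ∘ ψ) on Sⁿ is carried by ψ to a maximum of v f on Tⁿ.

open import Defs
open import Level using (Level)
open import Data.Product using (_×_; _,_; proj₁; proj₂; ∃-syntax)
open import Data.Empty using (⊥-elim)
open import Data.Fin as Fin using (Fin)
open import Data.Nat using (ℕ)
open import Function.Base using (_∘_)
open import Function.Bundles using (_⇔_; mk⇔; Equivalence)
open import Relation.Nullary using (¬_)
open import Relation.Unary using (Pred; _∈_)
open import Relation.Binary.PropositionalEquality as ≡
  using (_≡_; cong; cong₂; subst; subst₂; module ≡-Reasoning)
open import Algebra.Bundles using (AbelianGroup)
import Algebra.Properties.AbelianGroup as AbelianGroupProperties
import Algebra.Properties.Ring as RingProperties
import Relation.Binary.Reasoning.Setoid as SetoidReasoning

substitute : ∀ {a} {A : Set a} {m n : ℕ} →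
  Poly A m → (Fin m → Poly A n) → Poly A n
substitute (con k)  σ = con k
substitute (var i)  σ = σ i
substitute (p :+ q) σ = substitute p σ :+ substitute q σ
substitute (p :* q) σ = substitute p σ :* substitute q σ

_∘ₚ_ : ∀ {a} {A : Set a} {n : ℕ} → Poly A n → Poly A 1 → Poly A n
f ∘ₚ p = substitute f (λ i → substitute p (λ _ → var i))

module _ {c ℓ g : Level} (F : ValuedField c ℓ g) where
  open ValuedField F

  Γ-abelianGroup : AbelianGroup g g
  Γ-abelianGroup = record { isAbelianGroup = isAbelianGroup }

  private
    module ΓP = AbelianGroupProperties Γ-abelianGroup
    module KP = RingProperties ring
    module ≈-Reasoning = SetoidReasoning setoid

  infix 4 _≤ᵥ_
  _≤ᵥ_ : WithInf Γ → WithInf Γ → Set g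
  _≤ᵥ_ = _≤∞_ VG

  infixl 6 _+ᵥ_
  _+ᵥ_ : WithInf Γ → WithInf Γ → WithInf Γ
  _+ᵥ_ = _+∞_ VG

  eval-cong : ∀ {n} (f : Poly Carrier n) {x y : Fin n → Carrier} →
    (∀ i → x i ≈ y i) → eval F f x ≈ eval F f y
  eval-cong (con k)  x≈y = refl
  eval-cong (var i)  x≈y = x≈y i
  eval-cong (p :+ q) x≈y = +-cong (eval-cong p x≈y) (eval-cong q x≈y)
  eval-cong (p :* q) x≈y = *-cong (eval-cong p x≈y) (eval-cong q x≈y)

  eval-substitute : ∀ {m n} (f : Poly Carrier m) (σ : Fin m → Poly Carrier n)
    (x : Fin n → Carrier) →
    eval F (substitute f σ) x ≈ eval F f (λ i → eval F (σ i) x)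
  eval-substitute (con k)  σ x = refl
  eval-substitute (var i)  σ x = refl
  eval-substitute (p :+ q) σ x = +-cong (eval-substitute p σ x) (eval-substitute q σ x)
  eval-substitute (p :* q) σ x = *-cong (eval-substitute p σ x) (eval-substitute q σ x)

  ⟦_⟧₁ : Poly Carrier 1 → Carrier → Carrier
  ⟦ p ⟧₁ z = eval F p (λ _ → z)

  eval-∘ₚ : ∀ {n} (f : Poly Carrier n) (p : Poly Carrier 1) (x : Fin n → Carrier) →
    eval F (f ∘ₚ p) x ≈ eval F f (λ i → ⟦ p ⟧₁ (x i))
  eval-∘ₚ f p x = trans (eval-substitute f _ x)
    (eval-cong f (λ i → eval-substitute p (λ _ → var i) x))

  extremal-transfer : ∀ {s t} {S : Pred Carrier s} {T : Pred Carrier t}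
    (p : Poly Carrier 1) (ψ : Carrier → Carrier) → (∀ z → ⟦ p ⟧₁ z ≈ ψ z) →
    (∀ {z} → z ∈ S → ψ z ∈ T) →
    (∀ {y} → y ∈ T → ∃[ z ] (z ∈ S × ψ z ≈ y)) →
    IsExtremalOn F S → IsExtremalOn F T
  extremal-transfer {S = S} {T} p ψ p≈ψ into onto extS n f
    with extS n (f ∘ₚ p)
  ... | x , x∈S , x-maximises-f∘ψ = ψ ∘ x , into ∘ x∈S , maximal
    where
      eval-f∘ψ : ∀ z → eval F (f ∘ₚ p) z ≈ eval F f (ψ ∘ z)
      eval-f∘ψ z = trans (eval-∘ₚ f p z) (eval-cong f (p≈ψ ∘ z))

      maximal : ∀ y → (∀ i → y i ∈ T) → v (eval F f y) ≤ᵥ v (eval F f (ψ ∘ x))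
      maximal y y∈T =
        subst₂ _≤ᵥ_
          (v-cong (trans (eval-f∘ψ z) (eval-cong f (proj₂ ∘ proj₂ ∘ pre))))
          (v-cong (eval-f∘ψ x))
          (x-maximises-f∘ψ z (proj₁ ∘ proj₂ ∘ pre))
        where
          pre : ∀ i → ∃[ zᵢ ] (zᵢ ∈ S × ψ zᵢ ≈ y i)
          pre i = onto (y∈T i)

          z : Fin n → Carrier
          z = proj₁ ∘ pre

  +ᵥ-monoˡ : ∀ {γ} w δ → fin γ ≤ᵥ w → fin (γ +ᵍ δ) ≤ᵥ w +ᵥ fin δ
  +ᵥ-monoˡ (fin x) δ (fin≤fin γ≤x) = fin≤fin (+-mono-≤ δ γ≤x)
  +ᵥ-monoˡ ∞       δ (_ ≤∞∞)        = _ ≤∞∞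

  fin-injective : ∀ {x y : Γ} → fin x ≡ fin y → x ≡ y
  fin-injective ≡.refl = ≡.refl

  -- v 1 = 0, because v 1 = v 1 + v 1 and 1 ≉ 0.
  v-one : v 1# ≡ fin 0ᵍ
  v-one with v 1# in v1≡u
  ... | ∞     = ⊥-elim (1≉0 (Equivalence.to (v-∞ 1#) v1≡u))
  ... | fin u = cong fin (ΓP.identityˡ-unique u u (≡.sym (fin-injective u≡u+u)))
    where
      open ≡-Reasoning
      u≡u+u : fin u ≡ fin (u +ᵍ u)
      u≡u+u = begin
        fin u               ≡⟨ ≡.sym v1≡u ⟩
        v 1#                ≡⟨ v-cong (sym (*-identityˡ 1#)) ⟩
        v (1# * 1#)         ≡⟨ v-mult 1# 1# ⟩
        v 1# +ᵥ v 1#        ≡⟨ cong₂ _+ᵥ_ v1≡u v1≡u ⟩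
        fin (u +ᵍ u)        ∎

  +ᵥ-inverse : ∀ w δ → fin 0ᵍ ≡ w +ᵥ fin δ → w ≡ fin (-ᵍ δ)
  +ᵥ-inverse (fin ε) δ 0≡ε+δ = cong fin (ΓP.inverseˡ-unique ε δ (≡.sym (fin-injective 0≡ε+δ)))
  +ᵥ-inverse ∞       δ ()

  v-inverse : ∀ {d e δ} → e * d ≈ 1# → v d ≡ fin δ → v e ≡ fin (-ᵍ δ)
  v-inverse {d} {e} {δ} ed≈1 vd = +ᵥ-inverse (v e) δ (begin
    fin 0ᵍ           ≡⟨ ≡.sym v-one ⟩
    v 1#             ≡⟨ v-cong (sym ed≈1) ⟩
    v (e * d)        ≡⟨ v-mult e d ⟩
    v e +ᵥ v d      ≡⟨ cong (v e +ᵥ_) vd ⟩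
    v e +ᵥ fin δ    ∎)
    where open ≡-Reasoning

  finite-value⇒nonzero : ∀ {d δ} → v d ≡ fin δ → ¬ (d ≈ 0#)
  finite-value⇒nonzero {d} vd d≈0 with () ← ≡.trans (≡.sym vd) (Equivalence.from (v-∞ d) d≈0)

  unit-of-value : ∀ δ → ∃[ d ] ∃[ e ] (v d ≡ fin δ × v e ≡ fin (-ᵍ δ) × e * d ≈ 1#)
  unit-of-value δ with v-onto δ
  ... | d , vd with inverse d (finite-value⇒nonzero vd)
  ... | e , de≈1 = d , e , vd , v-inverse ed≈1 vd , ed≈1
    where
      ed≈1 : e * d ≈ 1#
      ed≈1 = trans (*-comm e d) de≈1

  x-[x-y]≈y : ∀ x y → x - (x - y) ≈ y
  x-[x-y]≈y x y = begin
    x - (x - y)     ≈⟨ +-congˡ (KP.⁻¹-anti-homo‿- x y) ⟩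
    x + (y - x)     ≈⟨ sym (+-assoc x y (- x)) ⟩
    x + y - x       ≈⟨ KP.xyx⁻¹≈y x y ⟩
    y               ∎
    where open ≈-Reasoning

  affine : Carrier → Carrier → Carrier → Carrier → Carrier
  affine a b d z = b - (a - z) * d

  affinePoly : Carrier → Carrier → Carrier → Poly Carrier 1
  affinePoly a b d = con b :+ ((con a :+ (con (- 1#) :* var Fin.zero)) :* con (- d))

  affinePoly-eval : ∀ a b d z → ⟦ affinePoly a b d ⟧₁ z ≈ affine a b d z
  affinePoly-eval a b d z = begin
    b + (a + - 1# * z) * - d   ≈⟨ +-congˡ (*-congʳ (+-congˡ (KP.-1*x≈-x z))) ⟩
    b + (a - z) * - d          ≈⟨ +-congˡ (sym (KP.-‿distribʳ-* (a - z) d)) ⟩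
    b - (a - z) * d            ∎
    where open ≈-Reasoning

  -- An affine map of slope d sends B_α(a) into B_{α + v d}(b), since
  -- b - affine a b d z = (a - z)·d.
  affine-ball : ∀ {α δ a d z} b → v d ≡ fin δ → z ∈ B F α a →
    affine a b d z ∈ B F (α +ᵍ δ) b
  affine-ball {α} {δ} {a} {d} {z} b vd z∈B =
    subst (fin (α +ᵍ δ) ≤ᵥ_) (≡.sym v[b-ψz]) (+ᵥ-monoˡ (v (a - z)) δ z∈B)
    where
      open ≡-Reasoning
      v[b-ψz] : v (b - affine a b d z) ≡ v (a - z) +ᵥ fin δ
      v[b-ψz] = begin
        v (b - affine a b d z)  ≡⟨ v-cong (x-[x-y]≈y b ((a - z) * d)) ⟩
        v ((a - z) * d)         ≡⟨ v-mult (a - z) d ⟩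
        v (a - z) +ᵥ v d        ≡⟨ cong (v (a - z) +ᵥ_) vd ⟩
        v (a - z) +ᵥ fin δ      ∎

  affine-inverse : ∀ a b {d e} → e * d ≈ 1# → ∀ y → affine a b d (affine b a e y) ≈ y
  affine-inverse a b {d} {e} ed≈1 y = begin
    b - (a - (a - (b - y) * e)) * d   ≈⟨ +-congˡ (-‿cong (*-congʳ (x-[x-y]≈y a _))) ⟩
    b - (b - y) * e * d               ≈⟨ +-congˡ (-‿cong (*-assoc (b - y) e d)) ⟩
    b - (b - y) * (e * d)             ≈⟨ +-congˡ (-‿cong (*-congˡ ed≈1)) ⟩
    b - (b - y) * 1#                  ≈⟨ +-congˡ (-‿cong (*-identityʳ (b - y))) ⟩
    b - (b - y)                       ≈⟨ x-[x-y]≈y b y ⟩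
    y                                 ∎
    where open ≈-Reasoning

  -- Extremality passes from any ball to any other ball: with v d = -α + β
  -- the affine map a ↦ b of slope d maps B_α(a) onto B_β(b).
  ball-transfer : ∀ α β a b → IsExtremalOn F (B F α a) → IsExtremalOn F (B F β b)
  ball-transfer α β a b with unit-of-value (-ᵍ α +ᵍ β)
  ... | d , e , vd , ve , ed≈1 =
    extremal-transfer (affinePoly a b d) (affine a b d) (affinePoly-eval a b d) into onto
    where
      into : ∀ {z} → z ∈ B F α a → affine a b d z ∈ B F β b
      into z∈B = subst (λ γ → affine a b d _ ∈ B F γ b)
        (ΓP.\\-leftDividesˡ α β) (affine-ball b vd z∈B)

      onto : ∀ {y} → y ∈ B F β b → ∃[ z ] (z ∈ B F α a × affine a b d z ≈ y)
      onto {y} y∈B = affine b a e y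
        , subst (λ γ → affine b a e y ∈ B F γ a) β-δ≡α (affine-ball a ve y∈B)
        , affine-inverse a b ed≈1 y
        where
          β-δ≡α : β +ᵍ -ᵍ (-ᵍ α +ᵍ β) ≡ α
          β-δ≡α = ≡.trans (cong (β +ᵍ_) (ΓP.⁻¹-anti-homo-\\ α β)) (ΓP.\\-leftDividesˡ β α)

  ball-extremality-independent : ∀ α β a b →
    IsExtremalOn F (B F α a) ⇔ IsExtremalOn F (B F β b)
  ball-extremality-independent α β a b = mk⇔ (ball-transfer α β a b) (ball-transfer β α b a)

proposition3p2 : ∀ {c ℓ g : Level} (F : ValuedField c ℓ g) →
    (∀ (α β : ValuedField.Γ F) (a b : ValuedField.Carrier F) →
       IsExtremalOn F (B F α a) ⇔ IsExtremalOn F (B F β b))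
    × (∀ (α : ValuedField.Γ F) (a : ValuedField.Carrier F) →
       IsExtremalOn F (B F α a) ⇔ IsExtremal F)
proposition3p2 F =
    ball-extremality-independent F
  , λ α a → ball-extremality-independent F α (ValuedField.0ᵍ F) a (ValuedField.0# F)
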